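{- Let $G=(V,E)$ be a connected block graph with no false twins (i.e., no two distinct vertices $u,v$ with $N(u)=N(v)$), and suppose $G$ is neither the path $P_2$ on two vertices nor the path $P_4$ on four vertices. Then $\gamma^{OLD}(G)\leq |V(G)|-1$.
   Context: All graphs are finite and simple. A block graph is a graph in which every maximal 2-connected subgraph (block) is a clique. For a vertex $u$, $N(u)$ denotes its open neighborhood. A set $C\subseteq V(G)$ is an open locating-dominating code (OLD-code) of $G$ if $N(u)\cap C\neq\emptyset$ for all $u\in V(G)$ and $N(u)\cap C\neq N(v)\cap C$ for all distinct $u,v\in V(G)$. $\gamma^{OLD}(G)$ is the minimum cardinality of an OLD-code of $G$. -}

module Defs where

open import Data.Nat using (ℕ; suc; _+_)
open import Data.Bool using (Bool; true; false)
open import Data.Fin using (Fin; toℕ)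
open import Data.Fin.Subset using (Subset; _∈_; _∉_; _⊆_)
open import Data.Product using (Σ; _×_; ∃-syntax)
open import Data.Sum using (_⊎_)
open import Data.Empty using (⊥)
open import Relation.Nullary using (¬_)
open import Relation.Binary.PropositionalEquality using (_≡_; _≢_)
open import Function.Bundles using (_↔_; Inverse)

record Graph : Set where
  field
    n     : ℕ
    adj   : Fin n → Fin n → Bool
    sym   : ∀ u v → adj u v ≡ adj v u
    loopless : ∀ u → adj u u ≡ false

open Graph public

module _ (G : Graph) where

  Adj : Fin (n G) → Fin (n G) → Set
  Adj u v = adj G u v ≡ true

  data WalkIn (S : Subset (n G)) : Fin (n G) → Fin (n G) → Set where
    here : ∀ {u} → WalkIn S u u
    step : ∀ {u w v} → Adj u w → w ∈ S → WalkIn S w v → WalkIn S u v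

  -- the subgraph induced by S is connected (the empty set counts as connected)
  InducedConnected : Subset (n G) → Set
  InducedConnected S = ∀ u v → u ∈ S → v ∈ S → WalkIn S u v

  _without_ : Subset (n G) → Fin (n G) → Subset (n G) 
  _without_ S x = Data.Fin.Subset._-_ S x

  Connected : Set
  Connected = ∀ u v → WalkIn Data.Fin.Subset.⊤ u v

  -- S induces a 2-connected subgraph in the block sense: G[S] is connected
  -- and has no cut vertex (this includes K1 and K2)
  Nonseparable : Subset (n G) → Set
  Nonseparable S = InducedConnected S × (∀ x → x ∈ S → InducedConnected (_without_ S x))

  IsBlock : Subset (n G) → Set
  IsBlock S = Nonseparable S × (∀ T → S ⊆ T → Nonseparable T → T ⊆ S)

  IsClique : Subset (n G) → Set
  IsClique S = ∀ u v → u ∈ S → v ∈ S → u ≢ v → Adj u v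

  BlockGraph : Set
  BlockGraph = ∀ S → IsBlock S → IsClique S

  NoFalseTwins : Set
  NoFalseTwins = ∀ u v → u ≢ v → ¬ (∀ w → adj G u w ≡ adj G v w)

  IsOLD : Subset (n G) → Set
  IsOLD C =
    (∀ u → ∃[ w ] (w ∈ C × Adj u w)) ×
    (∀ u v → u ≢ v → ¬ (∀ w → w ∈ C → adj G u w ≡ adj G v w))

pathAdj : ∀ k → Fin k → Fin k → Bool
pathAdj k i j with toℕ i Data.Nat.≟ toℕ j Data.Nat.+ 1 | toℕ j Data.Nat.≟ toℕ i Data.Nat.+ 1
... | Relation.Nullary.yes _ | _ = true
... | Relation.Nullary.no _ | Relation.Nullary.yes _ = true
... | Relation.Nullary.no _ | Relation.Nullary.no _ = false

IsoToPath : Graph → ℕ → Set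
IsoToPath G k = Σ (Fin (n G) ↔ Fin k) λ f →
  ∀ u v → adj G u v ≡ pathAdj k (Inverse.to f u) (Inverse.to f v)

-- Take C = V ∖ {x} for a well-chosen vertex x. It dominates unless x is the
-- only neighbour of a leaf. It separates two vertices u, v unless N(u) and N(v)
-- differ exactly in x; in a block graph without false twins this forces a path
-- x – u – a – v with N(u) = {a, x} and N(v) = {a}, since a second common
-- neighbour of u and v would close a 4-cycle, which lies in a clique block.
-- If G has no leaf any x works; otherwise a leaf works, unless G is P₂ or the
-- leaf starts such a path, and then the far end v of that path works unless
-- G is P₄.
module Submission where

open import Defs
open import Data.Nat using (_≤_; _∸_)
open import Data.Fin.Subset using (Subset; ∣_∣)
open import Data.Product using (∃-syntax; _×_)
open import Relation.Nullary using (¬_)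

open import Data.Nat using (ℕ; zero; suc; s≤s; z≤n; _+_)
import Data.Nat.Properties as ℕ
open import Data.Bool using (true; false)
import Data.Bool as Bool
open import Data.Vec using (_∷_)
open import Data.Fin using (Fin; zero; suc; _≟_)
open import Data.Fin.Properties using (any?; all?)
open import Data.Fin.Subset using (⊤; ⁅_⁆; _∪_; _-_; _∈_; _∉_; _⊆_; _⊂_)
open import Data.Fin.Subset.Properties
  using (_∈?_; ∣p∣≤n; ∈⊤; ∣⊤∣≡n; x∈⁅x⁆; x∈⁅y⁆⇒x≡y; x∈p∪q⁻; p⊆p∪q; q⊆p∪q;
         p─q⊆p; x∈p∧x≢y⇒x∈p-y; x∈p⇒∣p-x∣<∣p∣; p⊂q⇒∣p∣<∣q∣)
open import Data.Vec.Base using (there)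
open import Data.Product using (∃; _,_; proj₁; proj₂)
open import Data.Sum using (_⊎_; inj₁; inj₂; [_,_]′)
open import Data.Empty using (⊥; ⊥-elim)
open import Function using (id)
open import Relation.Nullary using (Dec; yes; no; ¬?)
open import Relation.Nullary.Decidable using (_×-dec_; _→-dec_; _⊎-dec_; decidable-stable; toWitness)
open import Relation.Binary.PropositionalEquality using (_≡_; refl; trans; subst; subst₂; _≢_; ≢-sym)
import Relation.Binary.PropositionalEquality as ≡
open import Function.Bundles using (mk↔ₛ′)

x∉p-x : ∀ {m} (p : Subset m) (x : Fin m) → x ∉ p - x
x∉p-x (_ ∷ p) zero    ()
x∉p-x (_ ∷ p) (suc x) (there x∈p) = x∉p-x p x x∈p

x∈p-y⇒x≢y : ∀ {m} {p : Subset m} {x y : Fin m} → x ∈ p - y → x ≢ y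
x∈p-y⇒x≢y {p = p} {x} x∈p-y refl = x∉p-x p x x∈p-y

x≢y⇒x∈⊤-y : ∀ {m} {x y : Fin m} → x ≢ y → x ∈ ⊤ - y
x≢y⇒x∈⊤-y x≢y = x∈p∧x≢y⇒x∈p-y ∈⊤ x≢y

∣⊤-x∣≤n∸1 : ∀ {m} (x : Fin m) → ∣ ⊤ - x ∣ ≤ m ∸ 1
∣⊤-x∣≤n∸1 {m} x =
  ℕ.∸-monoˡ-≤ 1 (subst (suc ∣ ⊤ - x ∣ ≤_) (∣⊤∣≡n m) (x∈p⇒∣p-x∣<∣p∣ {p = ⊤ {m}} (∈⊤ {x = x})))

another : ∀ {m} → 2 ≤ m → (y : Fin m) → ∃ λ z → z ≢ y
another (s≤s (s≤s _)) zero    = suc zero , λ ()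
another (s≤s (s≤s _)) (suc y) = zero , λ ()

PathHasNoTwins : ℕ → Set
PathHasNoTwins k = ∀ i j → (∀ l → pathAdj k i l ≡ pathAdj k j l) → i ≡ j

pathHasNoTwins? : ∀ k → Dec (PathHasNoTwins k)
pathHasNoTwins? k = all? λ i → all? λ j →
  all? (λ l → pathAdj k i l Bool.≟ pathAdj k j l) →-dec (i ≟ j)

path₂-no-twins : PathHasNoTwins 2
path₂-no-twins = toWitness {a? = pathHasNoTwins? 2} _

path₄-no-twins : PathHasNoTwins 4
path₄-no-twins = toWitness {a? = pathHasNoTwins? 4} _

module _ (G : Graph) where

  private
    V : Set
    V = Fin (n G)

    infix 4 _~_
    _~_ : V → V → Set
    _~_ = Adj G

  ~-sym : ∀ {u v} → u ~ v → v ~ u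
  ~-sym {u} {v} u~v = trans (Graph.sym G v u) u~v

  ~-irrefl : ∀ {u} → ¬ u ~ u
  ~-irrefl {u} u~u with trans (≡.sym (loopless G u)) u~u
  ... | ()

  ~⇒≢ : ∀ {u v} → u ~ v → u ≢ v
  ~⇒≢ u~u refl = ~-irrefl u~u

  _~?_ : ∀ u v → Dec (u ~ v)
  u ~? v = adj G u v Bool.≟ true

  ≁⇒false : ∀ {u v} → ¬ u ~ v → adj G u v ≡ false
  ≁⇒false {u} {v} u≁v with adj G u v
  ... | false = refl
  ... | true  = ⊥-elim (u≁v refl)

  false⇒≁ : ∀ {u v} → adj G u v ≡ false → ¬ u ~ v
  false⇒≁ uv≡false u~v with trans (≡.sym uv≡false) u~v
  ... | ()

  walk-++ : ∀ {S p q r} → WalkIn G S p q → WalkIn G S q r → WalkIn G S p r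
  walk-++ here           qr = qr
  walk-++ (step a wS pq) qr = step a wS (walk-++ pq qr)

  walk-reverse : ∀ {S p q} → p ∈ S → WalkIn G S p q → WalkIn G S q p
  walk-reverse pS here           = here
  walk-reverse pS (step a wS wq) = walk-++ (walk-reverse wS wq) (step (~-sym a) pS here)

  hub⇒connected : ∀ {S} h → (∀ p → p ∈ S → WalkIn G S p h) → InducedConnected G S
  hub⇒connected h toHub p q pS qS = walk-++ (toHub p pS) (walk-reverse qS (toHub q qS))

  star⇒connected : ∀ {S} h → h ∈ S → (∀ p → p ∈ S → p ≡ h ⊎ p ~ h) → InducedConnected G S
  star⇒connected h hS star = hub⇒connected h λ p pS →
    [ (λ { refl → here }) , (λ p~h → step p~h hS here) ]′ (star p pS)

  walk-first-step : ∀ {S y z} → z ≢ y → WalkIn G S y z → ∃ λ w → y ~ w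
  walk-first-step z≢y here         = ⊥-elim (z≢y refl)
  walk-first-step _   (step a _ _) = _ , a

  walk-preserves : (Q : V → Set) → (∀ {y z} → Q y → y ~ z → Q z) →
                   ∀ {S y z} → WalkIn G S y z → Q y → Q z
  walk-preserves Q closed here         qy = qy
  walk-preserves Q closed (step a _ w) qy = walk-preserves Q closed w (closed qy a)

  -- The fuel k bounds n - ∣ S ∣, the number of times S can still grow.
  nonseparable⇒¬¬block : ∀ k S → n G ≤ ∣ S ∣ + k → Nonseparable G S →
                         ¬ ¬ (∃ λ T → S ⊆ T × IsBlock G T)
  nonseparable⇒¬¬block k S bound nsS noBlock =
    noBlock (S , id , nsS , λ T S⊆T nsT {x} x∈T →
      decidable-stable (x ∈? S) (λ x∉S → noStrictExtension k bound T (S⊆T , x , x∈T , x∉S) nsT))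
    where
    noStrictExtension : ∀ k → n G ≤ ∣ S ∣ + k → ∀ T → S ⊂ T → ¬ Nonseparable G T
    noStrictExtension zero    bound T S⊂T _ = ℕ.<⇒≱ (p⊂q⇒∣p∣<∣q∣ S⊂T)
      (ℕ.≤-trans (∣p∣≤n T) (subst (n G ≤_) (ℕ.+-identityʳ _) bound))
    noStrictExtension (suc k) bound T S⊂T nsT =
      nonseparable⇒¬¬block k T bound′ nsT λ (U , T⊆U , blockU) →
        noBlock (U , (λ x∈S → T⊆U (proj₁ S⊂T x∈S)) , blockU)
      where
      bound′ : n G ≤ ∣ T ∣ + k
      bound′ = ℕ.≤-trans bound (ℕ.≤-trans (ℕ.≤-reflexive (ℕ.+-suc _ k))
                                          (ℕ.+-monoˡ-≤ k (p⊂q⇒∣p∣<∣q∣ S⊂T)))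

  nonseparable⇒clique : BlockGraph G → ∀ S → Nonseparable G S → IsClique G S
  nonseparable⇒clique blockGraph S nsS u v uS vS u≢v =
    decidable-stable (u ~? v) λ u≁v →
      nonseparable⇒¬¬block (n G) S (ℕ.m≤n+m _ _) nsS λ (T , S⊆T , blockT) →
        u≁v (blockGraph T blockT u v (S⊆T uS) (S⊆T vS) u≢v)

  square : V → V → V → V → Subset (n G)
  square u a v b = ⁅ u ⁆ ∪ ⁅ a ⁆ ∪ ⁅ v ⁆ ∪ ⁅ b ⁆

  module _ {u a v b : V} where

    private
      S : Subset (n G)
      S = square u a v b

      OneOf : V → Set
      OneOf x = x ≡ u ⊎ x ≡ a ⊎ x ≡ v ⊎ x ≡ b

    ∈-square⁺ : ∀ {x} → OneOf x → x ∈ S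
    ∈-square⁺ (inj₁ refl)                = p⊆p∪q (⁅ a ⁆ ∪ ⁅ v ⁆ ∪ ⁅ b ⁆) (x∈⁅x⁆ u)
    ∈-square⁺ (inj₂ (inj₁ refl))         = q⊆p∪q ⁅ u ⁆ _ (p⊆p∪q (⁅ v ⁆ ∪ ⁅ b ⁆) (x∈⁅x⁆ a))
    ∈-square⁺ (inj₂ (inj₂ (inj₁ refl))) = q⊆p∪q ⁅ u ⁆ _ (q⊆p∪q ⁅ a ⁆ _ (p⊆p∪q ⁅ b ⁆ (x∈⁅x⁆ v)))
    ∈-square⁺ (inj₂ (inj₂ (inj₂ refl))) = q⊆p∪q ⁅ u ⁆ _ (q⊆p∪q ⁅ a ⁆ _ (q⊆p∪q ⁅ v ⁆ ⁅ b ⁆ (x∈⁅x⁆ b)))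

    ∈-square⁻ : ∀ {x} → x ∈ S → OneOf x
    ∈-square⁻ x∈S with x∈p∪q⁻ ⁅ u ⁆ _ x∈S
    ... | inj₁ x∈u = inj₁ (x∈⁅y⁆⇒x≡y u x∈u)
    ... | inj₂ x∈avb with x∈p∪q⁻ ⁅ a ⁆ _ x∈avb
    ... | inj₁ x∈a = inj₂ (inj₁ (x∈⁅y⁆⇒x≡y a x∈a))
    ... | inj₂ x∈vb with x∈p∪q⁻ ⁅ v ⁆ _ x∈vb
    ... | inj₁ x∈v = inj₂ (inj₂ (inj₁ (x∈⁅y⁆⇒x≡y v x∈v)))
    ... | inj₂ x∈b = inj₂ (inj₂ (inj₂ (x∈⁅y⁆⇒x≡y b x∈b)))

    private
      u∈S : u ∈ S
      u∈S = ∈-square⁺ (inj₁ refl)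

      a∈S : a ∈ S
      a∈S = ∈-square⁺ (inj₂ (inj₁ refl))

      star-without : ∀ y h → OneOf h → h ≢ y → (∀ p → OneOf p → p ≢ y → p ≡ h ⊎ p ~ h) →
                     InducedConnected G (S - y)
      star-without y h h∈S h≢y star = star⇒connected h (x∈p∧x≢y⇒x∈p-y (∈-square⁺ h∈S) h≢y)
        λ p p∈S-y → star p (∈-square⁻ (p─q⊆p S ⁅ y ⁆ p∈S-y)) (x∈p-y⇒x≢y p∈S-y)

    -- Deleting a vertex of the 4-cycle u a v b leaves a path centred at the opposite vertex.
    square-nonseparable : u ~ a → v ~ a → u ~ b → v ~ b → u ≢ v → a ≢ b → Nonseparable G S
    square-nonseparable u~a v~a u~b v~b u≢v a≢b = hub⇒connected u toU , without
      where
      toU : ∀ p → p ∈ S → WalkIn G S p u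
      toU p p∈S with ∈-square⁻ p∈S
      ... | inj₁ refl                = here
      ... | inj₂ (inj₁ refl)         = step (~-sym u~a) u∈S here
      ... | inj₂ (inj₂ (inj₁ refl)) = step v~a a∈S (step (~-sym u~a) u∈S here)
      ... | inj₂ (inj₂ (inj₂ refl)) = step (~-sym u~b) u∈S here

      without : ∀ y → y ∈ S → InducedConnected G (S - y)
      without y y∈S with ∈-square⁻ y∈S
      ... | inj₁ refl = star-without u v (inj₂ (inj₂ (inj₁ refl))) (≢-sym u≢v) λ where
        _ (inj₁ refl) p≢u → ⊥-elim (p≢u refl)
        _ (inj₂ (inj₁ refl)) _ → inj₂ (~-sym v~a)
        _ (inj₂ (inj₂ (inj₁ refl))) _ → inj₁ refl
        _ (inj₂ (inj₂ (inj₂ refl))) _ → inj₂ (~-sym v~b)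
      ... | inj₂ (inj₁ refl) = star-without a b (inj₂ (inj₂ (inj₂ refl))) (≢-sym a≢b) λ where
        _ (inj₁ refl) _ → inj₂ u~b
        _ (inj₂ (inj₁ refl)) p≢a → ⊥-elim (p≢a refl)
        _ (inj₂ (inj₂ (inj₁ refl))) _ → inj₂ v~b
        _ (inj₂ (inj₂ (inj₂ refl))) _ → inj₁ refl
      ... | inj₂ (inj₂ (inj₁ refl)) = star-without v u (inj₁ refl) u≢v λ where
        _ (inj₁ refl) _ → inj₁ refl
        _ (inj₂ (inj₁ refl)) _ → inj₂ (~-sym u~a)
        _ (inj₂ (inj₂ (inj₁ refl))) p≢v → ⊥-elim (p≢v refl)
        _ (inj₂ (inj₂ (inj₂ refl))) _ → inj₂ (~-sym u~b)
      ... | inj₂ (inj₂ (inj₂ refl)) = star-without b a (inj₂ (inj₁ refl)) a≢b λ where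
        _ (inj₁ refl) _ → inj₂ u~a
        _ (inj₂ (inj₁ refl)) _ → inj₁ refl
        _ (inj₂ (inj₂ (inj₁ refl))) _ → inj₂ v~a
        _ (inj₂ (inj₂ (inj₂ refl))) p≢b → ⊥-elim (p≢b refl)

  -- A 4-cycle is nonseparable, hence inside a block, which is a clique.
  square-chord : BlockGraph G → ∀ {u a v b} → u ~ a → v ~ a → u ~ b → v ~ b → u ≢ v → a ≢ b → u ~ v
  square-chord blockGraph {u} {a} {v} {b} u~a v~a u~b v~b u≢v a≢b =
    nonseparable⇒clique blockGraph (square u a v b) (square-nonseparable u~a v~a u~b v~b u≢v a≢b)
      u v (∈-square⁺ (inj₁ refl)) (∈-square⁺ (inj₂ (inj₂ (inj₁ refl)))) u≢v

  Leaf : V → V → Set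
  Leaf l s = l ~ s × (∀ w → l ~ w → w ≡ s)

  Leaf? : ∀ l s → Dec (Leaf l s)
  Leaf? l s = (l ~? s) ×-dec all? (λ w → (l ~? w) →-dec (w ≟ s))

  LeafAt : V → Set
  LeafAt x = ∃ λ l → Leaf l x

  LeafAt? : ∀ x → Dec (LeafAt x)
  LeafAt? x = any? λ l → Leaf? l x

  PendantPathAt : V → Set
  PendantPathAt x = ∃ λ u → ∃ λ a → ∃ λ v →
    u ~ x × u ~ a × a ≢ x × (∀ w → u ~ w → w ≡ a ⊎ w ≡ x) × Leaf v a

  PendantPathAt? : ∀ x → Dec (PendantPathAt x)
  PendantPathAt? x = any? λ u → any? λ a → any? λ v →
    (u ~? x) ×-dec (u ~? a) ×-dec ¬? (a ≟ x) ×-dec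
    all? (λ w → (u ~? w) →-dec ((w ≟ a) ⊎-dec (w ≟ x))) ×-dec Leaf? v a

  agree-off⇒agree : ∀ {x u v} → adj G u x ≡ adj G v x → (∀ w → w ≢ x → adj G u w ≡ adj G v w) →
                    ∀ w → adj G u w ≡ adj G v w
  agree-off⇒agree {x} ux≡vx agreeOff w with w ≟ x
  ... | yes refl = ux≡vx
  ... | no w≢x   = agreeOff w w≢x

  module _ (conn : Connected G) where

    isoToPath : ∀ {k} (e : Fin (suc k) → V) → PathHasNoTwins (suc k) →
                (∀ i j → adj G (e i) (e j) ≡ pathAdj (suc k) i j) →
                (∀ i {y} → e i ~ y → ∃ λ j → e j ≡ y) → IsoToPath G (suc k)
    isoToPath {k} e pathNoTwins e-adj e-closed = mk↔ₛ′ to e to∘e e∘to , adj≡pathAdj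
      where
      e-surjective : ∀ y → ∃ λ i → e i ≡ y
      e-surjective y = walk-preserves (λ z → ∃ λ i → e i ≡ z)
        (λ { (i , refl) eᵢ~z → e-closed i eᵢ~z }) (conn (e zero) y) (zero , refl)

      e-injective : ∀ i j → e i ≡ e j → i ≡ j
      e-injective i j eᵢ≡eⱼ = pathNoTwins i j λ l → begin
        pathAdj (suc k) i l ≡⟨ e-adj i l ⟨
        adj G (e i) (e l)   ≡⟨ ≡.cong (λ z → adj G z (e l)) eᵢ≡eⱼ ⟩
        adj G (e j) (e l)   ≡⟨ e-adj j l ⟩
        pathAdj (suc k) j l ∎
        where open ≡.≡-Reasoning

      to : V → Fin (suc k)
      to y = proj₁ (e-surjective y)

      e∘to : ∀ y → e (to y) ≡ y
      e∘to y = proj₂ (e-surjective y)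

      to∘e : ∀ i → to (e i) ≡ i
      to∘e i = e-injective _ _ (e∘to (e i))

      adj≡pathAdj : ∀ u v → adj G u v ≡ pathAdj (suc k) (to u) (to v)
      adj≡pathAdj u v = subst₂ (λ u′ v′ → adj G u′ v′ ≡ pathAdj (suc k) (to u) (to v))
                               (e∘to u) (e∘to v) (e-adj (to u) (to v))

    leaf-at-leaf⇒P₂ : ∀ {l s} → Leaf l s → LeafAt l → IsoToPath G 2
    leaf-at-leaf⇒P₂ {l} {s} (l~s , N[l]) (u , u~l , N[u]) = isoToPath e path₂-no-twins e-adj e-closed
      where
      N[s] : ∀ w → s ~ w → w ≡ l
      N[s] w s~w = N[u] w (subst (_~ w) (≡.sym (N[l] u (~-sym u~l))) s~w)

      e : Fin 2 → V
      e zero       = l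
      e (suc zero) = s

      e-adj : ∀ i j → adj G (e i) (e j) ≡ pathAdj 2 i j
      e-adj zero       zero       = loopless G l
      e-adj zero       (suc zero) = l~s
      e-adj (suc zero) zero       = ~-sym l~s
      e-adj (suc zero) (suc zero) = loopless G s

      e-closed : ∀ i {y} → e i ~ y → ∃ λ j → e j ≡ y
      e-closed zero       l~y = suc zero , ≡.sym (N[l] _ l~y)
      e-closed (suc zero) s~y = zero , ≡.sym (N[s] _ s~y)

    module Spine {l s a v} (l-leaf : Leaf l s) (s~a : s ~ a) (N[s] : ∀ w → s ~ w → w ≡ a ⊎ w ≡ l)
                 (v-leaf : Leaf v a) (a≢l : a ≢ l) where

      private
        l~s : l ~ s
        l~s = proj₁ l-leaf

        N[l] : ∀ w → l ~ w → w ≡ s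
        N[l] = proj₂ l-leaf

        v~a : v ~ a
        v~a = proj₁ v-leaf

        N[v] : ∀ w → v ~ w → w ≡ a
        N[v] = proj₂ v-leaf

      s≢v : s ≢ v
      s≢v refl = a≢l (≡.sym (N[v] l (~-sym l~s)))

      l≢v : l ≢ v
      l≢v refl = ~⇒≢ s~a (N[v] s l~s)

      far-end-no-leaf : ¬ LeafAt v
      far-end-no-leaf (u , u~v , N[u]) =
        s≢v (N[u] s (subst (_~ s) (≡.sym (N[v] u (~-sym u~v))) (~-sym s~a)))

      far-end-path⇒P₄ : PendantPathAt v → IsoToPath G 4
      far-end-path⇒P₄ (u , b , _ , u~v , _ , _ , N[u] , _) = isoToPath e path₄-no-twins e-adj e-closed
        where
        N[a]′ : ∀ w → a ~ w → w ≡ b ⊎ w ≡ v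
        N[a]′ w a~w = N[u] w (subst (_~ w) (≡.sym (N[v] u (~-sym u~v))) a~w)

        N[a] : ∀ w → a ~ w → w ≡ s ⊎ w ≡ v
        N[a] w a~w with N[a]′ s (~-sym s~a) | N[a]′ w a~w
        ... | inj₂ s≡v | _        = ⊥-elim (s≢v s≡v)
        ... | inj₁ s≡b | inj₁ w≡b = inj₁ (trans w≡b (≡.sym s≡b))
        ... | inj₁ _   | inj₂ w≡v = inj₂ w≡v

        l≁a : ¬ l ~ a
        l≁a l~a = ~⇒≢ s~a (≡.sym (N[l] a l~a))

        l≁v : ¬ l ~ v
        l≁v l~v = s≢v (≡.sym (N[l] v l~v))

        s≁v : ¬ s ~ v
        s≁v s~v = [ (λ v≡a → ~⇒≢ v~a v≡a) , (λ v≡l → l≢v (≡.sym v≡l)) ]′ (N[s] v s~v)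

        e : Fin 4 → V
        e zero                   = l
        e (suc zero)             = s
        e (suc (suc zero))       = a
        e (suc (suc (suc zero))) = v

        e-adj : ∀ i j → adj G (e i) (e j) ≡ pathAdj 4 i j
        e-adj zero                   zero                   = loopless G l
        e-adj zero                   (suc zero)             = l~s
        e-adj zero                   (suc (suc zero))       = ≁⇒false l≁a
        e-adj zero                   (suc (suc (suc zero))) = ≁⇒false l≁v
        e-adj (suc zero)             zero                   = ~-sym l~s
        e-adj (suc zero)             (suc zero)             = loopless G s
        e-adj (suc zero)             (suc (suc zero))       = s~a
        e-adj (suc zero)             (suc (suc (suc zero))) = ≁⇒false s≁v
        e-adj (suc (suc zero))       zero                   = ≁⇒false (λ a~l → l≁a (~-sym a~l))
        e-adj (suc (suc zero))       (suc zero)             = ~-sym s~a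
        e-adj (suc (suc zero))       (suc (suc zero))       = loopless G a
        e-adj (suc (suc zero))       (suc (suc (suc zero))) = ~-sym v~a
        e-adj (suc (suc (suc zero))) zero                   = ≁⇒false (λ v~l → l≁v (~-sym v~l))
        e-adj (suc (suc (suc zero))) (suc zero)             = ≁⇒false (λ v~s → s≁v (~-sym v~s))
        e-adj (suc (suc (suc zero))) (suc (suc zero))       = v~a
        e-adj (suc (suc (suc zero))) (suc (suc (suc zero))) = loopless G v

        e-closed : ∀ i {y} → e i ~ y → ∃ λ j → e j ≡ y
        e-closed zero                   l~y = suc zero , ≡.sym (N[l] _ l~y)
        e-closed (suc zero)             s~y =
          [ (λ y≡a → suc (suc zero) , ≡.sym y≡a) , (λ y≡l → zero , ≡.sym y≡l) ]′ (N[s] _ s~y)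
        e-closed (suc (suc zero))       a~y =
          [ (λ y≡s → suc zero , ≡.sym y≡s) , (λ y≡v → suc (suc (suc zero)) , ≡.sym y≡v) ]′ (N[a] _ a~y)
        e-closed (suc (suc (suc zero))) v~y = suc (suc zero) , ≡.sym (N[v] _ v~y)

    module _ (two : 2 ≤ n G) where

      has-neighbour : ∀ u → ∃ λ w → u ~ w
      has-neighbour u = walk-first-step (proj₂ (another two u)) (conn u (proj₁ (another two u)))

      removal-dominating : ∀ x → ¬ LeafAt x → ∀ u → ∃[ w ] (w ∈ ⊤ - x × u ~ w)
      removal-dominating x noLeaf u with any? (λ w → (u ~? w) ×-dec ¬? (w ≟ x))
      ... | yes (w , u~w , w≢x) = w , x≢y⇒x∈⊤-y w≢x , u~w
      ... | no noOther = ⊥-elim (noLeaf (u , subst (u ~_) (onlyX _ u~w) u~w , onlyX))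
        where
        onlyX : ∀ w → u ~ w → w ≡ x
        onlyX w u~w = decidable-stable (w ≟ x) λ w≢x → noOther (w , u~w , w≢x)
        u~w : u ~ proj₁ (has-neighbour u)
        u~w = proj₂ (has-neighbour u)

      agree-off⇒PendantPathAt : BlockGraph G → ∀ {x u v} → u ≢ v → u ~ x → ¬ v ~ x →
                                (∀ w → w ≢ x → adj G u w ≡ adj G v w) → PendantPathAt x
      agree-off⇒PendantPathAt blockGraph {x} {u} {v} u≢v u~x v≁x agreeOff =
        u , a , v , u~x , u~a , a≢x , N[u] , v~a , N[v]
        where
        a : V
        a = proj₁ (has-neighbour v)
        v~a : v ~ a
        v~a = proj₂ (has-neighbour v)
        off-x : ∀ {w} → v ~ w → w ≢ x
        off-x v~x refl = v≁x v~x
        v≢x : v ≢ x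
        v≢x refl = ~-irrefl (trans (agreeOff u u≢v) (~-sym u~x))
        u≁v : ¬ u ~ v
        u≁v u~v = ~-irrefl (trans (≡.sym (agreeOff v v≢x)) u~v)
        a≢x : a ≢ x
        a≢x = off-x v~a
        u~a : u ~ a
        u~a = trans (agreeOff a a≢x) v~a
        N[v] : ∀ w → v ~ w → w ≡ a
        N[v] w v~w = decidable-stable (w ≟ a) λ w≢a →
          u≁v (square-chord blockGraph u~a v~a (trans (agreeOff w (off-x v~w)) v~w) v~w u≢v (≢-sym w≢a))
        N[u] : ∀ w → u ~ w → w ≡ a ⊎ w ≡ x
        N[u] w u~w with w ≟ x
        ... | yes w≡x = inj₂ w≡x
        ... | no w≢x  = inj₁ (N[v] w (trans (≡.sym (agreeOff w w≢x)) u~w))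

      removal-separating : BlockGraph G → NoFalseTwins G → ∀ x → ¬ PendantPathAt x →
                           ∀ u v → u ≢ v → ¬ (∀ w → w ∈ ⊤ - x → adj G u w ≡ adj G v w)
      removal-separating blockGraph noTwins x noPath u v u≢v agreeC =
        separate (λ w w≢x → agreeC w (x≢y⇒x∈⊤-y w≢x))
        where
        separate : (∀ w → w ≢ x → adj G u w ≡ adj G v w) → ⊥
        separate agreeOff with adj G u x in ux | adj G v x in vx
        ... | true  | true  = noTwins u v u≢v (agree-off⇒agree (trans ux (≡.sym vx)) agreeOff)
        ... | false | false = noTwins u v u≢v (agree-off⇒agree (trans ux (≡.sym vx)) agreeOff)
        ... | true  | false = noPath (agree-off⇒PendantPathAt blockGraph u≢v ux (false⇒≁ vx) agreeOff)
        ... | false | true  = noPath (agree-off⇒PendantPathAt blockGraph (≢-sym u≢v) vx (false⇒≁ ux)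
                                        λ w w≢x → ≡.sym (agreeOff w w≢x))

      removal-OLD : BlockGraph G → NoFalseTwins G → ∀ x → ¬ LeafAt x → ¬ PendantPathAt x → IsOLD G (⊤ - x)
      removal-OLD blockGraph noTwins x noLeaf noPath =
        removal-dominating x noLeaf , removal-separating blockGraph noTwins x noPath

      good-vertex : ¬ IsoToPath G 2 → ¬ IsoToPath G 4 → ∃ λ x → ¬ LeafAt x × ¬ PendantPathAt x
      good-vertex ¬P₂ ¬P₄ with any? (λ l → any? λ s → Leaf? l s)
      ... | no noLeaf = x₀ , (λ (l , leaf) → noLeaf (l , x₀ , leaf))
                           , (λ (_ , a , v , _ , _ , _ , _ , leaf) → noLeaf (v , a , leaf))
        where
        x₀ : V
        x₀ = Data.Fin.fromℕ< (ℕ.≤-trans (s≤s z≤n) two)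
      ... | yes (l , s , l-leaf) with LeafAt? l | PendantPathAt? l
      ...   | yes leafAtL | _         = ⊥-elim (¬P₂ (leaf-at-leaf⇒P₂ l-leaf leafAtL))
      ...   | no noLeafAtL | no noPathAtL = l , noLeafAtL , noPathAtL
      ...   | no _ | yes (u , a , v , u~l , u~a , a≢l , N[u] , v-leaf)
              with proj₂ l-leaf u (~-sym u~l)
      ...     | refl = v , far-end-no-leaf , λ path → ¬P₄ (far-end-path⇒P₄ path)
                where open Spine l-leaf u~a N[u] v-leaf a≢l

mainTheorem2 : (G : Graph) → 2 ≤ n G → Connected G → BlockGraph G → NoFalseTwins G →
    ¬ IsoToPath G 2 → ¬ IsoToPath G 4 →
    ∃[ C ] (IsOLD G C × ∣ C ∣ ≤ n G ∸ 1)
mainTheorem2 G two conn blockGraph noTwins ¬P₂ ¬P₄ =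
  let x , noLeaf , noPath = good-vertex G conn two ¬P₂ ¬P₄
  in ⊤ - x , removal-OLD G conn two blockGraph noTwins x noLeaf noPath , ∣⊤-x∣≤n∸1 x
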